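{- Let $b,s,k$ be positive integers, let $R=4bs-1$, and set \[ D:=R^{2k}+\left(bR^{2k}-s\right)^2. \] Define $e_1,\dots,e_{3k}$ by $e_{3j+1}=2bR^j-1$, $e_{3j+2}=1$, $e_{3j+3}=2bR^{2k-1-j}-1$ for $0\le j\le k-1$ (so the sequence is $2b-1,1,2bR^{2k-1}-1,\ 2bR-1,1,2bR^{2k-2}-1,\dots,2bR^{k-1}-1,1,2bR^k-1$). Then $l(D)=6k+1$ and \[ \sqrt D=[bR^{2k}-s;\overline{e_1,\dots,e_{3k},\,e_{3k},\dots,e_1,\,2(bR^{2k}-s)}]. \]
   Context: For a positive non-square integer $D$, $l(D)$ denotes the length of the fundamental (shortest) period of the regular continued fraction expansion of $\sqrt D$. $[a_0;\overline{b_1,\dots,b_m}]$ denotes the regular continued fraction whose partial quotients after $a_0$ are the block $b_1,\dots,b_m$ repeated infinitely often. -}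

module Defs where

open import Data.Nat as ℕ using (ℕ; zero; suc)
open import Data.Nat.DivMod using (_/_; _%_)
open import Data.Integer using (ℤ; +_; _+_; _-_; _*_; _^_; _≤_; _<_; 0ℤ; 1ℤ)
open import Data.Product using (Σ; _×_; ∃)
open import Data.Sum using (_⊎_)
open import Relation.Nullary using (yes; no)
open import Relation.Binary.PropositionalEquality using (_≡_)

-- Exact comparisons of an integer t with the real number √D (D ≥ 0 integer).
-- t ≤ √D  iff  t ≤ 0 or t² ≤ D
_≤√_ : ℤ → ℤ → Set
t ≤√ D = (t ≤ 0ℤ) ⊎ (t * t ≤ D)

√_<_ : ℤ → ℤ → Set
√ D < t = (0ℤ < t) × (D < t * t)

-- The regular continued fraction expansion of √D, expressed exactly via the
-- complete quotients x_n = (P n + √D) / Q n (with Q n > 0):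
--   x_0 = √D, a_n = ⌊x_n⌋, x_{n+1} = 1 / (x_n - a_n).
-- a_n = ⌊x_n⌋  is  a_n Q_n - P_n ≤ √D < (a_n + 1) Q_n - P_n,
-- and x_{n+1} = 1/(x_n - a_n) is P_{n+1} = a_n Q_n - P_n,
-- Q_{n+1} Q_n = D - P_{n+1}² (then 1/(x_n - a_n) = Q_n/(√D - P_{n+1})
-- = (P_{n+1} + √D)/Q_{n+1}).
record IsCFSqrt (D : ℤ) (a : ℕ → ℤ) : Set where
  field
    P Q   : ℕ → ℤ
    P0    : P 0 ≡ 0ℤ
    Q0    : Q 0 ≡ 1ℤ
    Qpos  : ∀ n → 0ℤ < Q n
    floorˡ : ∀ n → (a n * Q n - P n) ≤√ D
    floorʳ : ∀ n → √ D < ((a n + 1ℤ) * Q n - P n)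
    Pstep : ∀ n → P (suc n) ≡ a n * Q n - P n
    Qstep : ∀ n → Q (suc n) * Q n ≡ D - P (suc n) * P (suc n)

IsPeriod : (ℕ → ℤ) → ℕ → Set
IsPeriod a m = ∀ n → 1 ℕ.≤ n → a (n ℕ.+ m) ≡ a n

IsFundamentalPeriod : (ℕ → ℤ) → ℕ → Set
IsFundamentalPeriod a m =
  (1 ℕ.≤ m) × IsPeriod a m × (∀ m' → 1 ℕ.≤ m' → IsPeriod a m' → m ℕ.≤ m')

lIs : ℤ → ℕ → Set
lIs D m = ∀ a → IsCFSqrt D a → IsFundamentalPeriod a m

Rof : ℕ → ℕ → ℤ
Rof b s = + (4 ℕ.* b ℕ.* s) - 1ℤ

A0 : ℕ → ℕ → ℕ → ℤ
A0 b s k = + b * (Rof b s ^ (2 ℕ.* k)) - + s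

Dof : ℕ → ℕ → ℕ → ℤ
Dof b s k = Rof b s ^ (2 ℕ.* k) + A0 b s k * A0 b s k

-- e t = e_{t+1} (0-based): for t = 3j + r,
--   r = 0 : 2bR^j - 1,  r = 1 : 1,  r = 2 : 2bR^{2k-1-j} - 1
eSeq : ℕ → ℕ → ℕ → ℕ → ℤ
eSeq b s k t with t % 3
... | 0 = + (2 ℕ.* b) * (Rof b s ^ (t / 3)) - 1ℤ
... | 1 = 1ℤ
... | _ = + (2 ℕ.* b) * (Rof b s ^ (2 ℕ.* k ℕ.∸ 1 ℕ.∸ (t / 3))) - 1ℤ

-- The sequence [a₀; e_1,…,e_{3k}, e_{3k},…,e_1, 2a₀, (repeat)]
-- For n ≥ 1 with i = (n-1) mod (6k+1):
--   i < 3k : e_{i+1};  3k ≤ i < 6k : e_{6k-i};  i = 6k : 2 a₀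
cfSeq : ℕ → ℕ → ℕ → ℕ → ℤ
cfSeq b s k zero = A0 b s k
cfSeq b s k (suc n) = blockAt (n % suc (6 ℕ.* k))
  where
  blockAt : ℕ → ℤ
  blockAt i with i ℕ.<? 3 ℕ.* k | i ℕ.<? 6 ℕ.* k
  ... | yes _ | _     = eSeq b s k i
  ... | no _  | yes _ = eSeq b s k (6 ℕ.* k ℕ.∸ 1 ℕ.∸ i)
  ... | no _  | no _  = + 2 * A0 b s k

module Submission where

-- The complete quotients of √D are (P + √D)/Q with P′ = aQ − P and Q′Q = D − P′², and
-- a = ⌊(P + √D)/Q⌋ amounts to Q′ < 2P′ + Q; any integer sequence obeying these rules from
-- (P, Q) = (0, 1) is the expansion. The first half of the period consists of k blocks of three
-- steps, with partial quotients 2bR^j − 1, 1, 2bR^(2k−1−j) − 1; each step is a polynomial identity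
-- in b, s, R^j and R^(2(k−1−j)) together with a positivity check. After the last block the
-- denominator R^k repeats, and since every complete quotient after the first is reduced, the
-- second half of the period is the mirror image of the first, followed by (A, 1) with partial
-- quotient 2A. That value needs Q = 1 and so occurs nowhere else: the period 6k + 1 is the
-- shortest one.

open import Data.Nat as ℕ using (ℕ; zero; suc; z≤n; s≤s)
import Data.Nat.Properties as ℕ
open import Data.Nat.Divisibility using (n∣m*n)
open import Data.Nat.DivMod
  using ( _%_; _/_; m%n<n; m<n⇒m%n≡m; n%n≡0; m≡m%n+[m/n]*n; [m+kn]%n≡m%n; [m+n]%n≡m%n
        ; +-distrib-/-∣ʳ; m<n⇒m/n≡0; m*n/n≡m; m<n*o⇒m/o<n; /-monoˡ-≤)
open import Data.Integer as ℤ using (ℤ; +_; 0ℤ; 1ℤ; -1ℤ; +≤+; +<+; nonNegative; positive; >-nonZero)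
open import Data.Integer.Properties
  using ( ≤-refl; ≤-trans; _≤?_; ≰⇒>; <⇒≤; <-≤-trans; ≤-<-trans; ≤-antisym; <-irrefl; ≮⇒≥; _<?_
        ; module ≤-Reasoning; i-j≤i; 0≤i-j⇒j≤i; i≤j⇒0≤j-i; suc[i]≤j⇒i<j; i<j⇒suc[i]≤j; i<j⇒i≤pred[j]
        ; +-mono-≤-<; +-monoˡ-<; *-monoʳ-<-pos; *-monoʳ-≤-nonNeg; *-monoˡ-≤-nonNeg
        ; *-cancelˡ-<-nonNeg; *-cancelʳ-≡; *-comm; pos-*)
open import Data.Integer.Tactic.RingSolver using (solve-∀; ring)
open import Data.Nat.Tactic.RingSolver using () renaming (solve-∀ to ℕ-solve-∀)
open import Tactic.RingSolver.NonReflective ring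
  using (Expr; Κ; solve; _⊜_) renaming (_⊕_ to _⊞_; _⊗_ to _⊠_; ⊝_ to ⊟_)
open import Function using (_∘_)
open import Data.Product using (_×_; _,_; proj₁; proj₂)
open import Data.Sum using (inj₁; inj₂)
open import Data.Empty using (⊥-elim)
open import Relation.Nullary using (Dec; yes; no; ¬_)
open import Relation.Binary.PropositionalEquality
  using (_≡_; _≢_; refl; sym; trans; cong; cong₂; subst; subst₂; module ≡-Reasoning)

open import Defs

module Expansion where
  open import Data.Integer using (_+_; _-_; _*_; _≤_; _<_)

  square-mono : ∀ {x y} → 0ℤ ≤ x → x ≤ y → x * x ≤ y * y
  square-mono {x} {y} 0≤x x≤y =
    ≤-trans (*-monoʳ-≤-nonNeg x {{nonNegative 0≤x}} x≤y)
            (*-monoˡ-≤-nonNeg y {{nonNegative (≤-trans 0≤x x≤y)}} x≤y)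

  ≤√∧√<⇒< : ∀ {D t t′} → t ≤√ D → √ D < t′ → t < t′
  ≤√∧√<⇒< (inj₁ t≤0) (0<t′ , _) = ≤-<-trans t≤0 0<t′
  ≤√∧√<⇒< {D} {t} {t′} (inj₂ tt≤D) (0<t′ , D<t′t′) with t <? t′
  ... | yes t<t′ = t<t′
  ... | no t≮t′ = ⊥-elim (<-irrefl refl
    (<-≤-trans D<t′t′ (≤-trans (square-mono (<⇒≤ 0<t′) (≮⇒≥ t≮t′)) tt≤D)))

  *-pos : ∀ {x y} → 0ℤ < x → 0ℤ < y → 0ℤ < x * y
  *-pos (+<+ (s≤s z≤n)) (+<+ (s≤s z≤n)) = +<+ (s≤s z≤n)

  ≤-by-difference : ∀ {x y e} → y - x ≡ e → 0ℤ ≤ e → x ≤ y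
  ≤-by-difference eq 0≤e = 0≤i-j⇒j≤i (subst (0ℤ ≤_) (sym eq) 0≤e)

  private
    minus-suc : ∀ x y → y - (1ℤ + x) ≡ (y - x) - 1ℤ
    minus-suc = solve-∀

  <-by-difference : ∀ {x y e} → y - x ≡ e → 0ℤ < e → x < y
  <-by-difference {x} {y} eq 0<e = suc[i]≤j⇒i<j
    (≤-by-difference (trans (minus-suc x y) (cong (_- 1ℤ) eq)) (i≤j⇒0≤j-i (i<j⇒suc[i]≤j 0<e)))

  i<j⇒0<j-i : ∀ {i j} → i < j → 0ℤ < j - i
  i<j⇒0<j-i {i} {j} i<j =
    suc[i]≤j⇒i<j (0≤i-j⇒j≤i (subst (0ℤ ≤_) (minus-suc i j) (i≤j⇒0≤j-i (i<j⇒suc[i]≤j i<j))))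

  0≤i⇒0<i+1 : ∀ {i} → 0ℤ ≤ i → 0ℤ < i + 1ℤ
  0≤i⇒0<i+1 {+ m} _ = +<+ (ℕ.m≤n+m 1 m)

  infixl 6 _⊕_
  infixl 7 _⊗_

  _⊕_ : ∀ {x y} → 0ℤ ≤ x → 0ℤ ≤ y → 0ℤ ≤ x + y
  +≤+ _ ⊕ +≤+ _ = +≤+ z≤n

  _⊗_ : ∀ {x y} → 0ℤ ≤ x → 0ℤ ≤ y → 0ℤ ≤ x * y
  _⊗_ {+ m} {+ n} _ _ = subst (0ℤ ≤_) (pos-* m n) (+≤+ z≤n)

  lit : ∀ n → 0ℤ ≤ + n
  lit _ = +≤+ z≤n

  -- Continued fraction steps

  -- From x = (P + √D)/Q with partial quotient a to x′ = (P′ + √D)/Q′.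
  -- Given next-Q, the condition below says √D < P′ + Q, i.e. a = ⌊x⌋.
  record Step (D P Q a P′ Q′ : ℤ) : Set where
    field
      next-P : P′ ≡ a * Q - P
      next-Q : Q′ * Q ≡ D - P′ * P′
      below  : Q′ < P′ + P′ + Q

  step⇒D≡ : ∀ {D P Q a P′ Q′} → Step D P Q a P′ Q′ → D ≡ Q′ * Q + P′ * P′
  step⇒D≡ {D} {P′ = P′} step = trans (split D (P′ * P′)) (cong (_+ P′ * P′) (sym (Step.next-Q step)))
    where
    split : ∀ D p → D ≡ (D - p) + p
    split = solve-∀

  module _ {D P Q a P′ Q′ : ℤ} (step : Step D P Q a P′ Q′) (0<Q : 0ℤ < Q) where
    open Step step

    step⇒P′²<D : 0ℤ < Q′ → P′ * P′ < D
    step⇒P′²<D 0<Q′ = <-by-difference (sym next-Q) (*-pos 0<Q′ 0<Q)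

    step⇒floorˡ : 0ℤ < Q′ → (a * Q - P) ≤√ D
    step⇒floorˡ 0<Q′ = inj₂ (subst (λ t → t * t ≤ D) next-P (<⇒≤ (step⇒P′²<D 0<Q′)))

    step⇒√D<P′+Q : 0ℤ ≤ P′ → √ D < (P′ + Q)
    step⇒√D<P′+Q 0≤P′ = +-mono-≤-< 0≤P′ 0<Q , (begin-strict
      D                        ≡⟨ step⇒D≡ step ⟩
      Q′ * Q + P′ * P′         <⟨ +-monoˡ-< (P′ * P′) (*-monoʳ-<-pos Q {{positive 0<Q}} below) ⟩
      (P′ + P′ + Q) * Q + P′ * P′ ≡⟨ square P′ Q ⟩
      (P′ + Q) * (P′ + Q)      ∎)
      where
      open ≤-Reasoning
      square : ∀ P′ Q → (P′ + P′ + Q) * Q + P′ * P′ ≡ (P′ + Q) * (P′ + Q)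
      square = solve-∀

    step⇒floorʳ : 0ℤ ≤ P′ → √ D < ((a + 1ℤ) * Q - P)
    step⇒floorʳ 0≤P′ = subst (λ t → √ D < t) (sym (trans (expand a Q P) (cong (_+ Q) (sym next-P))))
                                  (step⇒√D<P′+Q 0≤P′)
      where
      expand : ∀ a Q P → (a + 1ℤ) * Q - P ≡ (a * Q - P) + Q
      expand = solve-∀

  floor-≤ : ∀ {D P Q c c′} → 0ℤ < Q → (c′ * Q - P) ≤√ D → √ D < ((c + 1ℤ) * Q - P) → c′ ≤ c
  floor-≤ {D} {P} {Q} {c} {c′} 0<Q lower upper = ≮⇒≥ λ c<c′ →
    <-irrefl refl (<-≤-trans (≤√∧√<⇒< lower upper)
      (≤-by-difference (difference c c′ Q P) (i≤j⇒0≤j-i (i<j⇒suc[i]≤j c<c′) ⊗ <⇒≤ 0<Q)))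
    where
    difference : ∀ c c′ Q P → (c′ * Q - P) - ((c + 1ℤ) * Q - P) ≡ (c′ - (1ℤ + c)) * Q
    difference = solve-∀

  floor-unique : ∀ {D P Q c c′} → 0ℤ < Q →
    (c * Q - P) ≤√ D → √ D < ((c + 1ℤ) * Q - P) →
    (c′ * Q - P) ≤√ D → √ D < ((c′ + 1ℤ) * Q - P) → c ≡ c′
  floor-unique 0<Q lower upper lower′ upper′ =
    ≤-antisym (floor-≤ 0<Q lower upper′) (floor-≤ 0<Q lower′ upper)

  module _ {D : ℤ} {a a′ : ℕ → ℤ} (cf : IsCFSqrt D a) (cf′ : IsCFSqrt D a′) where
    private
      module C  = IsCFSqrt cf
      module C′ = IsCFSqrt cf′

    states-agree : ∀ n → C.P n ≡ C′.P n × C.Q n ≡ C′.Q n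
    quotients-agree : ∀ n → a n ≡ a′ n

    quotients-agree n with states-agree n
    ... | P≡ , Q≡ = floor-unique (C.Qpos n) (C.floorˡ n) (C.floorʳ n)
      (subst₂ (λ P Q → (a′ n * Q - P) ≤√ D) (sym P≡) (sym Q≡) (C′.floorˡ n))
      (subst₂ (λ P Q → √ D < ((a′ n + 1ℤ) * Q - P)) (sym P≡) (sym Q≡) (C′.floorʳ n))

    states-agree zero = trans C.P0 (sym C′.P0) , trans C.Q0 (sym C′.Q0)
    states-agree (suc n) with states-agree n
    ... | P≡ , Q≡ = P′≡ , *-cancelʳ-≡ _ _ (C.Q n) {{>-nonZero (C.Qpos n)}} (begin
      C.Q (suc n) * C.Q n         ≡⟨ C.Qstep n ⟩
      D - C.P (suc n) * C.P (suc n) ≡⟨ cong (λ x → D - x * x) P′≡ ⟩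
      D - C′.P (suc n) * C′.P (suc n) ≡⟨ sym (C′.Qstep n) ⟩
      C′.Q (suc n) * C′.Q n        ≡⟨ cong (C′.Q (suc n) *_) (sym Q≡) ⟩
      C′.Q (suc n) * C.Q n         ∎)
      where
      open ≡-Reasoning
      P′≡ : C.P (suc n) ≡ C′.P (suc n)
      P′≡ = trans (C.Pstep n) (trans (cong₂ (λ x y → x * y - C.P n) (quotients-agree n) Q≡)
                   (trans (cong (a′ n * C′.Q n -_) P≡) (sym (C′.Pstep n))))

  fundamental-period-cong : ∀ {a a′ m} → (∀ n → a n ≡ a′ n) →
    IsFundamentalPeriod a m → IsFundamentalPeriod a′ m
  fundamental-period-cong {a} {a′} {m} a≡a′ (1≤m , period , minimal) =
    1≤m ,
    (λ n 1≤n → trans (sym (a≡a′ (n ℕ.+ m))) (trans (period n 1≤n) (a≡a′ n))) ,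
    (λ m′ 1≤m′ period′ → minimal m′ 1≤m′ λ n 1≤n →
       trans (a≡a′ (n ℕ.+ m′)) (trans (period′ n 1≤n) (sym (a≡a′ n))))

  lIs-of-expansion : ∀ {D a m} → IsCFSqrt D a → IsFundamentalPeriod a m → lIs D m
  lIs-of-expansion cf fundamental a′ cf′ =
    fundamental-period-cong (quotients-agree cf cf′) fundamental

  module _ {D P Q a P′ Q′ : ℤ} (step : Step D P Q a P′ Q′) (0<Q : 0ℤ < Q) (0<Q′ : 0ℤ < Q′) where
    open Step step

    -- The conclusion says (P′ − √D)/Q′ > −1: the complete quotient after one with a ≥ 1 and
    -- 0 ≤ P < √D is reduced. In integers it amounts to (Q − P′)² < D.
    step-reduced : 1ℤ ≤ a → 0ℤ ≤ P → P * P < D → 0ℤ ≤ P′ → Q < P′ + P′ + Q′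
    step-reduced 1≤a 0≤P P²<D 0≤P′ = *-cancelˡ-<-nonNeg Q {{nonNegative (<⇒≤ 0<Q)}}
      (<-by-difference (trans (expand Q P′ Q′) (cong (_- (Q - P′) * (Q - P′)) (sym D≡)))
                       (i<j⇒0<j-i gap²<D))
      where
      expand : ∀ Q P′ Q′ → Q * (P′ + P′ + Q′) - Q * Q ≡ (Q′ * Q + P′ * P′) - (Q - P′) * (Q - P′)
      expand = solve-∀
      D≡ : D ≡ Q′ * Q + P′ * P′
      D≡ = step⇒D≡ step
      gap²<D : (Q - P′) * (Q - P′) < D
      gap²<D with P′ ≤? Q
      ... | yes P′≤Q = ≤-<-trans (square-mono (i≤j⇒0≤j-i P′≤Q) Q-P′≤P) P²<D
        where
        rearrange : ∀ a Q P → P - (Q - (a * Q - P)) ≡ (a - 1ℤ) * Q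
        rearrange = solve-∀
        Q-P′≤P : Q - P′ ≤ P
        Q-P′≤P = ≤-by-difference (trans (cong (λ x → P - (Q - x)) next-P) (rearrange a Q P))
                                 (i≤j⇒0≤j-i 1≤a ⊗ <⇒≤ 0<Q)
      ... | no P′≰Q = ≤-<-trans (subst (_≤ P′ * P′) (flip Q P′) (square-mono (i≤j⇒0≤j-i Q≤P′) P′-Q≤P′))
                                (step⇒P′²<D step 0<Q 0<Q′)
        where
        flip : ∀ Q P′ → (P′ - Q) * (P′ - Q) ≡ (Q - P′) * (Q - P′)
        flip = solve-∀
        Q≤P′ : Q ≤ P′
        Q≤P′ = <⇒≤ (≰⇒> P′≰Q)
        P′-Q≤P′ : P′ - Q ≤ P′
        P′-Q≤P′ = i-j≤i P′ Q {{nonNegative (<⇒≤ 0<Q)}}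

  step-mirror : ∀ {D P₀ Q₀ a₀ P Q a P′ Q′} → Step D P₀ Q₀ a₀ P Q → Step D P Q a P′ Q′ →
    Q₀ < P + P + Q → Step D P′ Q a P Q₀
  step-mirror {Q₀ = Q₀} {P = P} {Q} {a} previous step Q₀<2P+Q = record
    { next-P = trans (rearrange a Q P) (cong (a * Q -_) (sym (Step.next-P step)))
    ; next-Q = trans (*-comm Q₀ Q) (Step.next-Q previous)
    ; below  = Q₀<2P+Q
    }
    where
    rearrange : ∀ a Q P → P ≡ a * Q - (a * Q - P)
    rearrange = solve-∀

  step-from-zero : ∀ {D A a Q′} → Step D A 1ℤ a A Q′ → Step D 0ℤ 1ℤ A A Q′
  step-from-zero {A = A} step = record
    { next-P = unit A ; next-Q = Step.next-Q step ; below = Step.below step }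
    where
    unit : ∀ A → A ≡ A * 1ℤ - 0ℤ
    unit = solve-∀

  step-quotient≢2A : ∀ {D P Q a P′ Q′ A} → Step D P Q a P′ Q′ →
    + 2 ≤ Q → P ≤ A → P′ ≤ A → 1ℤ ≤ A → a ≢ + 2 * A
  step-quotient≢2A {P = P} {Q} {P′ = P′} {A = A} step 2≤Q P≤A P′≤A 1≤A refl =
    <-irrefl (trans (sym vanishes) (excess A Q P P′))
      (0≤i⇒0<i+1 (lit 2 ⊗ A≥0 ⊗ i≤j⇒0≤j-i 2≤Q ⊕ i≤j⇒0≤j-i P′≤A ⊕ i≤j⇒0≤j-i P≤A
                     ⊕ lit 2 ⊗ i≤j⇒0≤j-i 1≤A ⊕ lit 1))
    where
    A≥0 : 0ℤ ≤ A
    A≥0 = ≤-trans (+≤+ z≤n) 1≤A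
    cancel : ∀ x P → x - ((x - P) + P) ≡ 0ℤ
    cancel = solve-∀
    vanishes : + 2 * A * Q - (P′ + P) ≡ 0ℤ
    vanishes = trans (cong (λ p → + 2 * A * Q - (p + P)) (Step.next-P step)) (cancel (+ 2 * A * Q) P)
    excess : ∀ A Q P P′ → + 2 * A * Q - (P′ + P)
                          ≡ + 2 * A * (Q - + 2) + (A - P′) + (A - P) + + 2 * (A - 1ℤ) + 1ℤ + 1ℤ
    excess = solve-∀

  period-minimal : ∀ {a N c} → IsPeriod a N → a N ≡ c → (∀ i → 1 ℕ.≤ i → i ℕ.< N → a i ≢ c) →
    ∀ m → 1 ℕ.≤ m → IsPeriod a m → N ℕ.≤ m
  period-minimal {a} {N} {c} period aN≡c others m 1≤m period-m with N ℕ.≤? m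
  ... | yes N≤m = N≤m
  ... | no N≰m = ⊥-elim (others m 1≤m m<N (begin
    a m           ≡⟨ sym (period m 1≤m) ⟩
    a (m ℕ.+ N)   ≡⟨ cong a (ℕ.+-comm m N) ⟩
    a (N ℕ.+ m)   ≡⟨ period-m N (ℕ.≤-trans 1≤m (ℕ.<⇒≤ m<N)) ⟩
    a N           ≡⟨ aN≡c ⟩
    c             ∎))
    where
    open ≡-Reasoning
    m<N : m ℕ.< N
    m<N = ℕ.≰⇒> N≰m

  steps⇒IsCFSqrt : ∀ {D a} (P Q : ℕ → ℤ) → P 0 ≡ 0ℤ → Q 0 ≡ 1ℤ →
    (∀ n → 0ℤ < Q n) → (∀ n → 0ℤ ≤ P (suc n)) →
    (∀ n → Step D (P n) (Q n) (a n) (P (suc n)) (Q (suc n))) → IsCFSqrt D a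
  steps⇒IsCFSqrt P Q P0 Q0 0<Q 0≤P step = record
    { P = P ; Q = Q ; P0 = P0 ; Q0 = Q0 ; Qpos = 0<Q
    ; floorˡ = λ n → step⇒floorˡ (step n) (0<Q n) (0<Q (suc n))
    ; floorʳ = λ n → step⇒floorʳ (step n) (0<Q n) (0≤P n)
    ; Pstep  = λ n → Step.next-P (step n)
    ; Qstep  = λ n → Step.next-Q (step n)
    }

  Step-cong : ∀ {D P Q a P′ Q′ D₂ P₂ Q₂ a₂ P′₂ Q′₂} →
    D ≡ D₂ → P ≡ P₂ → Q ≡ Q₂ → a ≡ a₂ → P′ ≡ P′₂ → Q′ ≡ Q′₂ →
    Step D₂ P₂ Q₂ a₂ P′₂ Q′₂ → Step D P Q a P′ Q′
  Step-cong refl refl refl refl refl refl step = step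

  -- Palindromic periods

  -- The complete quotients (p u + √D)/q u, u ≤ n + 1, of the first half of a period, starting
  -- from A + √D. The centre condition q (n + 1) = q n makes the second half the mirror image.
  record PalindromicChain (D A : ℤ) (n : ℕ) (p q d : ℕ → ℤ) : Set where
    field
      1≤n    : 1 ℕ.≤ n
      p₀     : p 0 ≡ A
      p₁     : p 1 ≡ A
      q₀     : q 0 ≡ 1ℤ
      d₀     : d 0 ≡ + 2 * A
      centre : q (suc n) ≡ q n
      step   : ∀ {u} → u ℕ.≤ n → Step D (p u) (q u) (d u) (p (suc u)) (q (suc u))
      p≥0    : ∀ {u} → u ℕ.≤ suc n → 0ℤ ≤ p u
      q≥2    : ∀ {u} → 1 ℕ.≤ u → u ℕ.≤ suc n → + 2 ≤ q u
      d≥1    : ∀ {u} → u ℕ.≤ n → 1ℤ ≤ d u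

  -- Position i = 0 … 2n of the period carries the partial quotient d (fold n i).
  fold : ℕ → ℕ → ℕ
  fold n i with i ℕ.<? n
  ... | yes _ = suc i
  ... | no _  = n ℕ.+ n ℕ.∸ i

  ∸-suc : ∀ {m i} → i ℕ.< m → m ℕ.∸ i ≡ suc (m ℕ.∸ suc i)
  ∸-suc {suc m} {zero}  _         = refl
  ∸-suc {suc m} {suc i} (s≤s i<m) = ∸-suc i<m

  module Palindrome {D A : ℤ} {n : ℕ} {p q d : ℕ → ℤ} (chain : PalindromicChain D A n p q d) where
    open PalindromicChain chain

    N : ℕ
    N = suc (n ℕ.+ n)

    P-at Q-at d-at : ℕ → ℤ
    P-at i with i ℕ.<? n
    ... | yes _ = p (suc i)
    ... | no _  = p (suc (n ℕ.+ n ℕ.∸ i))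
    Q-at i = q (fold n i)
    d-at i = d (fold n i)

    at-forward : ∀ {i} → i ℕ.< n → P-at i ≡ p (suc i) × fold n i ≡ suc i
    at-forward {i} i<n with i ℕ.<? n
    ... | yes _   = refl , refl
    ... | no i≮n = ⊥-elim (i≮n i<n)

    at-mirror : ∀ {i} → ¬ i ℕ.< n → P-at i ≡ p (suc (n ℕ.+ n ℕ.∸ i)) × fold n i ≡ n ℕ.+ n ℕ.∸ i
    at-mirror {i} i≮n with i ℕ.<? n
    ... | yes i<n = ⊥-elim (i≮n i<n)
    ... | no _    = refl , refl

    mirror≤n : ∀ {i} → ¬ i ℕ.< n → n ℕ.+ n ℕ.∸ i ℕ.≤ n
    mirror≤n {i} i≮n = ℕ.≤-trans (ℕ.∸-monoʳ-≤ (n ℕ.+ n) (ℕ.≮⇒≥ i≮n)) (ℕ.≤-reflexive (ℕ.m+n∸n≡m n n))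

    fold≤n : ∀ i → fold n i ℕ.≤ n
    fold≤n i with i ℕ.<? n
    ... | yes i<n = i<n
    ... | no i≮n  = mirror≤n i≮n

    P-at-index : {R : ℤ → Set} → (∀ {u} → u ℕ.≤ suc n → R (p u)) → ∀ i → R (P-at i)
    P-at-index h i with i ℕ.<? n
    ... | yes i<n = h (ℕ.m≤n⇒m≤1+n i<n)
    ... | no i≮n  = h (s≤s (mirror≤n i≮n))

    q-pos : ∀ {u} → u ℕ.≤ suc n → 0ℤ < q u
    q-pos {zero}  _   = subst (0ℤ <_) (sym q₀) (+<+ (s≤s z≤n))
    q-pos {suc u} u≤n = <-≤-trans (+<+ (s≤s z≤n)) (q≥2 (s≤s z≤n) u≤n)

    p²<D : ∀ {u} → u ℕ.≤ suc n → p u * p u < D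
    p²<D {zero}  _           = subst (λ x → x * x < D) (trans p₁ (sym p₀)) (p²<D (s≤s z≤n))
    p²<D {suc u} (s≤s u≤n) = step⇒P′²<D (step u≤n) (q-pos (ℕ.m≤n⇒m≤1+n u≤n)) (q-pos (s≤s u≤n))

    p≤A : ∀ {u} → u ℕ.≤ suc n → p u ≤ A
    p≤A u≤ = subst (_ ≤_) (cancel A) (i<j⇒i≤pred[j] (≤√∧√<⇒< (inj₂ (<⇒≤ (p²<D u≤))) √D<A+1))
      where
      cancel : ∀ A → -1ℤ + (A + 1ℤ) ≡ A
      cancel = solve-∀
      √D<A+1 : √ D < (A + 1ℤ)
      √D<A+1 = subst₂ (λ x y → √ D < (x + y)) p₁ q₀
                 (step⇒√D<P′+Q (step z≤n) (q-pos z≤n) (p≥0 (s≤s z≤n)))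

    Transition : ℕ → ℕ → Set
    Transition i j = Step D (P-at i) (Q-at i) (d-at i) (P-at j) (Q-at j)

    forward-step : ∀ {i} → suc i ℕ.< n → Transition i (suc i)
    forward-step {i} 1+i<n with at-forward (ℕ.<-trans (ℕ.n<1+n i) 1+i<n) | at-forward 1+i<n
    ... | P≡ , f≡ | P′≡ , f′≡ =
      Step-cong refl P≡ (cong q f≡) (cong d f≡) P′≡ (cong q f′≡) (step (ℕ.<⇒≤ 1+i<n))

    centre-step : ∀ {i} → suc i ≡ n → Transition i (suc i)
    centre-step {i} 1+i≡n
      with at-forward (ℕ.≤-reflexive 1+i≡n) | at-mirror (λ 1+i<n → ℕ.<-irrefl 1+i≡n 1+i<n)
    ... | P≡ , f≡ | P′≡ , f′≡ =
      Step-cong refl (trans P≡ (cong p 1+i≡n)) (cong q (trans f≡ 1+i≡n)) (cong d (trans f≡ 1+i≡n))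
                (trans P′≡ (cong (λ u → p (suc u)) middle)) (trans (cong q (trans f′≡ middle)) (sym centre))
                (step ℕ.≤-refl)
      where
      middle : n ℕ.+ n ℕ.∸ suc i ≡ n
      middle = trans (cong (n ℕ.+ n ℕ.∸_) 1+i≡n) (ℕ.m+n∸n≡m n n)

    -- The mirrored step goes from (P_{u+1}, Q_u) to (P_u, Q_{u-1}); its bound is the reducedness
    -- of the complete quotient u.
    mirror-step : ∀ {i} → ¬ i ℕ.< n → suc i ℕ.≤ n ℕ.+ n → Transition i (suc i)
    mirror-step {i} i≮n 1+i≤2n
      with at-mirror i≮n | at-mirror (λ 1+i<n → i≮n (ℕ.<-trans (ℕ.n<1+n i) 1+i<n))
    ... | P≡ , f≡ | P′≡ , f′≡ =
      Step-cong refl (trans P≡ (cong (λ u → p (suc u)) u≡)) (cong q (trans f≡ u≡)) (cong d (trans f≡ u≡))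
                P′≡ (cong q f′≡)
                (step-mirror (step w≤n) (step 1+w≤n)
                  (step-reduced (step w≤n) (q-pos (ℕ.m≤n⇒m≤1+n w≤n)) (q-pos (s≤s w≤n))
                    (d≥1 w≤n) (p≥0 (ℕ.m≤n⇒m≤1+n w≤n)) (p²<D (ℕ.m≤n⇒m≤1+n w≤n)) (p≥0 (s≤s w≤n))))
      where
      w : ℕ
      w = n ℕ.+ n ℕ.∸ suc i
      u≡ : n ℕ.+ n ℕ.∸ i ≡ suc w
      u≡ = ∸-suc 1+i≤2n
      1+w≤n : suc w ℕ.≤ n
      1+w≤n = subst (ℕ._≤ n) u≡ (mirror≤n i≮n)
      w≤n : w ℕ.≤ n
      w≤n = ℕ.<⇒≤ 1+w≤n

    wrap-step : Transition (n ℕ.+ n) 0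
    wrap-step with at-mirror (ℕ.≤⇒≯ (ℕ.m≤n+m n n)) | at-forward 1≤n
    ... | P≡ , f≡ | P′≡ , f′≡ =
      Step-cong refl (trans P≡ (cong (λ u → p (suc u)) top)) (cong q (trans f≡ top)) (cong d (trans f≡ top))
                P′≡ (cong q f′≡) (Step-cong refl (trans p₁ (sym p₀)) refl refl refl refl (step z≤n))
      where
      top : n ℕ.+ n ℕ.∸ (n ℕ.+ n) ≡ 0
      top = ℕ.n∸n≡0 (n ℕ.+ n)

    step-within : ∀ {i} → suc i ℕ.≤ n ℕ.+ n → Transition i (suc i)
    step-within {i} 1+i≤2n = by-side (i ℕ.<? n)
      where
      by-side : Dec (i ℕ.< n) → Transition i (suc i)
      by-side (no i≮n)  = mirror-step i≮n 1+i≤2n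
      by-side (yes i<n) = in-first-half (suc i ℕ.<? n)
        where
        in-first-half : Dec (suc i ℕ.< n) → Transition i (suc i)
        in-first-half (yes 1+i<n) = forward-step 1+i<n
        in-first-half (no 1+i≮n)  = centre-step (ℕ.≤-antisym i<n (ℕ.≮⇒≥ 1+i≮n))

    position-step : ∀ {i} → i ℕ.< N → Transition i (suc i % N)
    position-step {i} (s≤s i≤2n) with ℕ.m≤n⇒m<n∨m≡n i≤2n
    ... | inj₁ i<2n  = subst (Transition i) (sym (m<n⇒m%n≡m (s≤s i<2n))) (step-within i<2n)
    ... | inj₂ refl = subst (Transition i) (sym (n%n≡0 N)) wrap-step

    1≤A : 1ℤ ≤ A
    1≤A = 1≤2x⇒1≤x (subst (1ℤ ≤_) d₀ (d≥1 z≤n))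
      where
      1≤2x⇒1≤x : ∀ {x} → 1ℤ ≤ + 2 * x → 1ℤ ≤ x
      1≤2x⇒1≤x {+ suc _} _ = +≤+ (s≤s z≤n)
      1≤2x⇒1≤x {+ zero} (+≤+ ())

    cf-P cf-Q : ℕ → ℤ
    cf-P zero    = 0ℤ
    cf-P (suc m) = P-at (m % N)
    cf-Q zero    = 1ℤ
    cf-Q (suc m) = Q-at (m % N)

    module _ (a : ℕ → ℤ) (a₀ : a 0 ≡ A) (a-suc : ∀ m → a (suc m) ≡ d-at (m % N)) where

      cf-step : ∀ m → Step D (cf-P m) (cf-Q m) (a m) (cf-P (suc m)) (cf-Q (suc m))
      cf-step zero with at-forward 1≤n
      ... | P≡ , f≡ = Step-cong refl refl refl a₀ (trans P≡ p₁) (cong q f≡)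
        (step-from-zero (Step-cong refl (sym p₀) (sym q₀) refl (sym p₁) refl (step z≤n)))
      cf-step (suc m) = Step-cong refl refl refl (a-suc m) (cong P-at (suc-% m)) (cong Q-at (suc-% m))
        (position-step (m%n<n m N))
        where
        suc-% : ∀ m → suc m % N ≡ suc (m % N) % N
        suc-% m = trans (cong (λ x → suc x % N) (m≡m%n+[m/n]*n m N)) ([m+kn]%n≡m%n (suc (m % N)) (m / N) N)

      expansion : IsCFSqrt D a
      expansion = steps⇒IsCFSqrt cf-P cf-Q refl refl cf-Q-pos cf-P-nonneg cf-step
        where
        cf-Q-pos : ∀ m → 0ℤ < cf-Q m
        cf-Q-pos zero    = +<+ (s≤s z≤n)
        cf-Q-pos (suc m) = q-pos (ℕ.m≤n⇒m≤1+n (fold≤n (m % N)))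
        cf-P-nonneg : ∀ m → 0ℤ ≤ cf-P (suc m)
        cf-P-nonneg m = P-at-index {0ℤ ≤_} p≥0 (m % N)

      fundamental : IsFundamentalPeriod a N
      fundamental = s≤s z≤n , period , period-minimal period aN≡2A not-2A
        where
        period : IsPeriod a N
        period (suc m) _ = trans (a-suc (m ℕ.+ N)) (trans (cong d-at ([m+n]%n≡m%n m N)) (sym (a-suc m)))

        a-within : ∀ {i} → i ℕ.< N → a (suc i) ≡ d-at i
        a-within i<N = trans (a-suc _) (cong d-at (m<n⇒m%n≡m i<N))

        aN≡2A : a N ≡ + 2 * A
        aN≡2A with at-mirror (ℕ.≤⇒≯ (ℕ.m≤n+m n n))
        ... | _ , f≡ = trans (a-within ℕ.≤-refl) (trans (cong d (trans f≡ (ℕ.n∸n≡0 (n ℕ.+ n)))) d₀)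

        1≤fold : ∀ {i} → i ℕ.< n ℕ.+ n → 1 ℕ.≤ fold n i
        1≤fold {i} i<2n with i ℕ.<? n
        ... | yes _ = s≤s z≤n
        ... | no _  = subst (1 ℕ.≤_) (sym (∸-suc i<2n)) (s≤s z≤n)

        not-2A : ∀ j → 1 ℕ.≤ j → j ℕ.< N → a j ≢ + 2 * A
        not-2A (suc i) _ (s≤s i<2n) aj≡2A =
          step-quotient≢2A (step-within i<2n) (q≥2 (1≤fold i<2n) (ℕ.m≤n⇒m≤1+n (fold≤n i)))
            (P-at-index {_≤ A} p≤A i) (P-at-index {_≤ A} p≤A (suc i)) 1≤A
            (trans (sym (a-within (s≤s (ℕ.<⇒≤ i<2n)))) aj≡2A)

  palindromic-expansion : ∀ {D A n p q d} → PalindromicChain D A n p q d →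
    (a : ℕ → ℤ) → a 0 ≡ A → (∀ m → a (suc m) ≡ d (fold n (m % suc (n ℕ.+ n)))) →
    IsCFSqrt D a × IsFundamentalPeriod a (suc (n ℕ.+ n))
  palindromic-expansion chain a a₀ a-suc = expansion a a₀ a-suc , fundamental a a₀ a-suc
    where open Palindrome chain

-- The blocks of the period

record RingSyntax (C : Set) : Set where
  infixl 6 _+_ _-_
  infixl 7 _*_
  field
    _+_ _-_ _*_ : C → C → C
    κ           : ℕ → C

ℤ-syntax : RingSyntax ℤ
ℤ-syntax = record { _+_ = ℤ._+_ ; _-_ = ℤ._-_ ; _*_ = ℤ._*_ ; κ = +_ }

expr-syntax : ∀ {n} → RingSyntax (Expr ℤ n)
expr-syntax = record { _+_ = _⊞_ ; _-_ = λ x y → x ⊞ ⊟ y ; _*_ = _⊠_ ; κ = λ n → Κ (+ n) }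

-- Block j < k of the first half of the period has X = R^j and W = R^(2(k-1-j)), so that
-- Y = R^(2k-j), T = R^(2k) and Z = R^(2k-1-j). It runs through the states
-- (A, Y) →eX→ (P₁, Q₁) →1→ (P₂, R X) →eZ→ (A, Z). The quantities are written once, over any
-- ring syntax, so that they serve both as integers and as input to the ring solver.
module Shape {C : Set} (ops : RingSyntax C) (b s X W : C) where
  open RingSyntax ops public

  R Y T Z A D P₁ Q₁ P₂ eX eZ β σ ξ ω : C
  R  = κ 4 * b * s - κ 1
  Y  = R * R * X * W
  T  = X * Y
  Z  = R * X * W
  A  = b * T - s
  D  = T + A * A
  P₁ = A - Y + κ 2 * s
  Q₁ = κ 2 * A - Y + κ 4 * s - R * X
  P₂ = A + κ 2 * s - R * X
  eX = κ 2 * b * X - κ 1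
  eZ = κ 2 * b * Z - κ 1
  β  = b - κ 1
  σ  = s - κ 1
  ξ  = X - κ 1
  ω  = W - κ 1

module BlockIdentities where

  R-expanded : ∀ b s X W → let open Shape ℤ-syntax b s X W in
    R ≡ κ 4 * β * s + κ 4 * σ + κ 3
  R-expanded = solve 4 (λ b s X W → let open Shape expr-syntax b s X W in
    R ⊜ (κ 4 * β * s + κ 4 * σ + κ 3)) refl

  A-1-expanded : ∀ b s X W → let open Shape ℤ-syntax b s X W in
    A - κ 1 ≡ β * T + R * (R * (X * X * ω + ξ * (X + κ 1)) + κ 4 * β * s + κ 4 * σ + κ 2)
                    + κ 4 * β * s + κ 3 * σ + κ 1
  A-1-expanded = solve 4 (λ b s X W → let open Shape expr-syntax b s X W in
    A - κ 1 ⊜ (β * T + R * (R * (X * X * ω + ξ * (X + κ 1)) + κ 4 * β * s + κ 4 * σ + κ 2)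
                    + κ 4 * β * s + κ 3 * σ + κ 1)) refl

  P₁-expanded : ∀ b s X W → let open Shape ℤ-syntax b s X W in
    P₁ ≡ β * T + Y * ξ + s
  P₁-expanded = solve 4 (λ b s X W → let open Shape expr-syntax b s X W in
    P₁ ⊜ (β * T + Y * ξ + s)) refl

  P₂-expanded : ∀ b s X W → let open Shape ℤ-syntax b s X W in
    P₂ ≡ β * T + R * X * (R * X * ω + R * ξ + κ 4 * β * s + κ 4 * σ + κ 2) + s
  P₂-expanded = solve 4 (λ b s X W → let open Shape expr-syntax b s X W in
    P₂ ⊜ (β * T + R * X * (R * X * ω + R * ξ + κ 4 * β * s + κ 4 * σ + κ 2) + s)) refl

  Q₁-2-expanded : ∀ b s X W → let open Shape ℤ-syntax b s X W in
    Q₁ - κ 2 ≡ κ 2 * β * T + Y * ξ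
                     + R * X * (R * X * ω + R * ξ + κ 4 * β * s + κ 4 * σ + κ 2) + κ 2 * σ
  Q₁-2-expanded = solve 4 (λ b s X W → let open Shape expr-syntax b s X W in
    Q₁ - κ 2 ⊜ (κ 2 * β * T + Y * ξ
                     + R * X * (R * X * ω + R * ξ + κ 4 * β * s + κ 4 * σ + κ 2) + κ 2 * σ)) refl

  top-gap : ∀ b s X W → let open Shape ℤ-syntax b s X W in
    (A + A + κ 1) - T ≡ κ 2 * β * T
                         + R * (R * (X * X * ω + ξ * (X + κ 1)) + κ 4 * β * s + κ 4 * σ + κ 2)
                         + κ 4 * β * s + κ 2 * σ + κ 1 + κ 1
  top-gap = solve 4 (λ b s X W → let open Shape expr-syntax b s X W in
    (A + A + κ 1) - T ⊜ (κ 2 * β * T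
                         + R * (R * (X * X * ω + ξ * (X + κ 1)) + κ 4 * β * s + κ 4 * σ + κ 2)
                         + κ 4 * β * s + κ 2 * σ + κ 1 + κ 1)) refl

  P₁-next : ∀ b s X W → let open Shape ℤ-syntax b s X W in
    P₁ ≡ eX * Y - A
  P₁-next = solve 4 (λ b s X W → let open Shape expr-syntax b s X W in
    P₁ ⊜ (eX * Y - A)) refl

  Q₁-next : ∀ b s X W → let open Shape ℤ-syntax b s X W in
    Q₁ * Y ≡ D - P₁ * P₁
  Q₁-next = solve 4 (λ b s X W → let open Shape expr-syntax b s X W in
    Q₁ * Y ⊜ (D - P₁ * P₁)) refl

  gap₀ : ∀ b s X W → let open Shape ℤ-syntax b s X W in
    (P₁ + P₁ + Y) - Q₁ ≡ R * ξ + κ 4 * β * s + κ 4 * σ + κ 2 + κ 1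
  gap₀ = solve 4 (λ b s X W → let open Shape expr-syntax b s X W in
    (P₁ + P₁ + Y) - Q₁ ⊜ (R * ξ + κ 4 * β * s + κ 4 * σ + κ 2 + κ 1)) refl

  P₂-next : ∀ b s X W → let open Shape ℤ-syntax b s X W in
    P₂ ≡ κ 1 * Q₁ - P₁
  P₂-next = solve 4 (λ b s X W → let open Shape expr-syntax b s X W in
    P₂ ⊜ (κ 1 * Q₁ - P₁)) refl

  RX-next : ∀ b s X W → let open Shape ℤ-syntax b s X W in
    R * X * Q₁ ≡ D - P₂ * P₂
  RX-next = solve 4 (λ b s X W → let open Shape expr-syntax b s X W in
    R * X * Q₁ ⊜ (D - P₂ * P₂)) refl

  gap₁ : ∀ b s X W → let open Shape ℤ-syntax b s X W in
    (P₂ + P₂ + Q₁) - R * X ≡ κ 4 * β * T + Y * ξ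
                              + κ 3 * (R * X * (R * X * ω + R * ξ + κ 4 * β * s + κ 4 * σ + κ 1))
                              + κ 2 * (R * X) + κ 4 * σ + κ 3 + κ 1
  gap₁ = solve 4 (λ b s X W → let open Shape expr-syntax b s X W in
    (P₂ + P₂ + Q₁) - R * X ⊜ (κ 4 * β * T + Y * ξ
                              + κ 3 * (R * X * (R * X * ω + R * ξ + κ 4 * β * s + κ 4 * σ + κ 1))
                              + κ 2 * (R * X) + κ 4 * σ + κ 3 + κ 1)) refl

  A-next : ∀ b s X W → let open Shape ℤ-syntax b s X W in
    A ≡ eZ * (R * X) - P₂
  A-next = solve 4 (λ b s X W → let open Shape expr-syntax b s X W in
    A ⊜ (eZ * (R * X) - P₂)) refl

  Z-next : ∀ b s X W → let open Shape ℤ-syntax b s X W in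
    Z * (R * X) ≡ D - A * A
  Z-next = solve 4 (λ b s X W → let open Shape expr-syntax b s X W in
    Z * (R * X) ⊜ (D - A * A)) refl

  gap₂ : ∀ b s X W → let open Shape ℤ-syntax b s X W in
    (A + A + R * X) - Z ≡ κ 2 * β * T + κ 2 * (R * X * W * (R * ξ + κ 4 * β * s + κ 4 * σ + κ 2))
                           + R * X * ω + R * ξ + κ 4 * β * s + κ 2 * σ + R * X + κ 1
  gap₂ = solve 4 (λ b s X W → let open Shape expr-syntax b s X W in
    (A + A + R * X) - Z ⊜ (κ 2 * β * T + κ 2 * (R * X * W * (R * ξ + κ 4 * β * s + κ 4 * σ + κ 2))
                           + R * X * ω + R * ξ + κ 4 * β * s + κ 2 * σ + R * X + κ 1)) refl

module Block (b s X W : ℤ) (1≤b : 1ℤ ℤ.≤ b) (1≤s : 1ℤ ℤ.≤ s) (1≤X : 1ℤ ℤ.≤ X) (1≤W : 1ℤ ℤ.≤ W)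
  where
  open import Data.Integer using (_+_; _-_; _*_; _≤_; _<_)
  open import Data.Integer.Properties using (+-monoˡ-≤)
  open Expansion
  open BlockIdentities
  open Shape ℤ-syntax b s X W public using (R; Y; T; Z; A; D; P₁; Q₁; P₂; eX; eZ; β; σ; ξ; ω)

  private
    β≥0 : 0ℤ ≤ β
    β≥0 = i≤j⇒0≤j-i 1≤b
    σ≥0 : 0ℤ ≤ σ
    σ≥0 = i≤j⇒0≤j-i 1≤s
    ξ≥0 : 0ℤ ≤ ξ
    ξ≥0 = i≤j⇒0≤j-i 1≤X
    ω≥0 : 0ℤ ≤ ω
    ω≥0 = i≤j⇒0≤j-i 1≤W
    s≥0 : 0ℤ ≤ s
    s≥0 = ≤-trans (lit 1) 1≤s
    X≥0 : 0ℤ ≤ X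
    X≥0 = ≤-trans (lit 1) 1≤X
    W≥0 : 0ℤ ≤ W
    W≥0 = ≤-trans (lit 1) 1≤W

  R≥3 : + 3 ≤ R
  R≥3 = subst (+ 3 ≤_) (sym (R-expanded b s X W)) (+-monoˡ-≤ (+ 3) (lit 4 ⊗ β≥0 ⊗ s≥0 ⊕ lit 4 ⊗ σ≥0))

  private
    R≥0 : 0ℤ ≤ R
    R≥0 = ≤-trans (lit 3) R≥3
    Y≥0 : 0ℤ ≤ Y
    Y≥0 = R≥0 ⊗ R≥0 ⊗ X≥0 ⊗ W≥0
    T≥0 : 0ℤ ≤ T
    T≥0 = X≥0 ⊗ Y≥0
    RX≥0 : 0ℤ ≤ R * X
    RX≥0 = R≥0 ⊗ X≥0

  1≤A : 1ℤ ≤ A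
  1≤A = ≤-by-difference (A-1-expanded b s X W)
    (β≥0 ⊗ T≥0
     ⊕ R≥0 ⊗ (R≥0 ⊗ (X≥0 ⊗ X≥0 ⊗ ω≥0 ⊕ ξ≥0 ⊗ (X≥0 ⊕ lit 1)) ⊕ lit 4 ⊗ β≥0 ⊗ s≥0 ⊕ lit 4 ⊗ σ≥0 ⊕ lit 2)
     ⊕ lit 4 ⊗ β≥0 ⊗ s≥0 ⊕ lit 3 ⊗ σ≥0 ⊕ lit 1)

  P₁≥0 : 0ℤ ≤ P₁
  P₁≥0 = subst (0ℤ ≤_) (sym (P₁-expanded b s X W)) (β≥0 ⊗ T≥0 ⊕ Y≥0 ⊗ ξ≥0 ⊕ s≥0)

  P₂≥0 : 0ℤ ≤ P₂
  P₂≥0 = subst (0ℤ ≤_) (sym (P₂-expanded b s X W))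
    (β≥0 ⊗ T≥0 ⊕ RX≥0 ⊗ (RX≥0 ⊗ ω≥0 ⊕ R≥0 ⊗ ξ≥0 ⊕ lit 4 ⊗ β≥0 ⊗ s≥0 ⊕ lit 4 ⊗ σ≥0 ⊕ lit 2)
     ⊕ s≥0)

  Q₁≥2 : + 2 ≤ Q₁
  Q₁≥2 = ≤-by-difference (Q₁-2-expanded b s X W)
    (lit 2 ⊗ β≥0 ⊗ T≥0 ⊕ Y≥0 ⊗ ξ≥0
     ⊕ RX≥0 ⊗ (RX≥0 ⊗ ω≥0 ⊕ R≥0 ⊗ ξ≥0 ⊕ lit 4 ⊗ β≥0 ⊗ s≥0 ⊕ lit 4 ⊗ σ≥0 ⊕ lit 2)
     ⊕ lit 2 ⊗ σ≥0)

  top-step : Step D A 1ℤ (+ 2 * A) A T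
  top-step = record
    { next-P = twice A
    ; next-Q = unit T A
    ; below  = <-by-difference (top-gap b s X W) (0≤i⇒0<i+1
        (lit 2 ⊗ β≥0 ⊗ T≥0
         ⊕ R≥0 ⊗ (R≥0 ⊗ (X≥0 ⊗ X≥0 ⊗ ω≥0 ⊕ ξ≥0 ⊗ (X≥0 ⊕ lit 1)) ⊕ lit 4 ⊗ β≥0 ⊗ s≥0 ⊕ lit 4 ⊗ σ≥0 ⊕ lit 2)
         ⊕ lit 4 ⊗ β≥0 ⊗ s≥0 ⊕ lit 2 ⊗ σ≥0 ⊕ lit 1))
    }
    where
    twice : ∀ A → A ≡ + 2 * A * 1ℤ - A
    twice = solve-∀
    unit : ∀ T A → T * 1ℤ ≡ (T + A * A) - A * A
    unit = solve-∀

  step₀ : Step D A Y eX P₁ Q₁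
  step₀ = record
    { next-P = P₁-next b s X W
    ; next-Q = Q₁-next b s X W
    ; below  = <-by-difference (gap₀ b s X W)
        (0≤i⇒0<i+1 (R≥0 ⊗ ξ≥0 ⊕ lit 4 ⊗ β≥0 ⊗ s≥0 ⊕ lit 4 ⊗ σ≥0 ⊕ lit 2))
    }

  step₁ : Step D P₁ Q₁ 1ℤ P₂ (R * X)
  step₁ = record
    { next-P = P₂-next b s X W
    ; next-Q = RX-next b s X W
    ; below  = <-by-difference (gap₁ b s X W) (0≤i⇒0<i+1
        (lit 4 ⊗ β≥0 ⊗ T≥0 ⊕ Y≥0 ⊗ ξ≥0
         ⊕ lit 3 ⊗ (RX≥0 ⊗ (RX≥0 ⊗ ω≥0 ⊕ R≥0 ⊗ ξ≥0 ⊕ lit 4 ⊗ β≥0 ⊗ s≥0 ⊕ lit 4 ⊗ σ≥0 ⊕ lit 1))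
         ⊕ lit 2 ⊗ RX≥0 ⊕ lit 4 ⊗ σ≥0 ⊕ lit 3))
    }

  step₂ : Step D P₂ (R * X) eZ A Z
  step₂ = record
    { next-P = A-next b s X W
    ; next-Q = Z-next b s X W
    ; below  = <-by-difference (gap₂ b s X W) (0≤i⇒0<i+1
        (lit 2 ⊗ β≥0 ⊗ T≥0
         ⊕ lit 2 ⊗ (RX≥0 ⊗ W≥0 ⊗ (R≥0 ⊗ ξ≥0 ⊕ lit 4 ⊗ β≥0 ⊗ s≥0 ⊕ lit 4 ⊗ σ≥0 ⊕ lit 2))
         ⊕ RX≥0 ⊗ ω≥0 ⊕ R≥0 ⊗ ξ≥0 ⊕ lit 4 ⊗ β≥0 ⊗ s≥0 ⊕ lit 2 ⊗ σ≥0 ⊕ RX≥0))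
    }

-- The period of √D in Corollary 6

module Corollary6 (b s k : ℕ) (1≤b : 1 ℕ.≤ b) (1≤s : 1 ℕ.≤ s) (1≤k : 1 ℕ.≤ k) where
  open import Data.Integer using (_+_; _-_; _*_; _^_; _≤_; _<_)
  open import Data.Integer.Properties using (^-distribˡ-+-*; *-identityʳ)
  open Expansion

  R A D : ℤ
  R = Rof b s
  A = A0 b s k
  D = Dof b s k

  X W : ℕ → ℤ
  X j = R ^ j
  W j = R ^ (2 ℕ.* (k ℕ.∸ suc j))

  R-block : + 4 * + b * + s - 1ℤ ≡ R
  R-block = cong (_- 1ℤ) (sym (trans (pos-* (4 ℕ.* b) s) (cong (_* + s) (pos-* 4 b))))

  -- The bound on R involves neither X nor W.
  R≥3 : + 3 ≤ R
  R≥3 = subst (+ 3 ≤_) R-block (Block.R≥3 (+ b) (+ s) 1ℤ 1ℤ (+≤+ 1≤b) (+≤+ 1≤s) ≤-refl ≤-refl)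

  R^≥1 : ∀ e → 1ℤ ≤ R ^ e
  R≤R^suc : ∀ e → R ≤ R ^ suc e

  R^≥1 zero    = ≤-refl
  R^≥1 (suc e) = ≤-trans (≤-trans (+≤+ (s≤s z≤n)) R≥3) (R≤R^suc e)

  R≤R^suc e = subst (_≤ R ^ suc e) (*-identityʳ R)
    (*-monoˡ-≤-nonNeg R {{nonNegative (≤-trans (lit 3) R≥3)}} (R^≥1 e))

  R^suc≥2 : ∀ e → + 2 ≤ R ^ suc e
  R^suc≥2 e = ≤-trans (≤-trans (+≤+ (s≤s (s≤s z≤n))) R≥3) (R≤R^suc e)

  module B (j : ℕ) =
    Block (+ b) (+ s) (X j) (W j) (+≤+ 1≤b) (+≤+ 1≤s) (R^≥1 j) (R^≥1 (2 ℕ.* (k ℕ.∸ suc j)))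

  private
    double-split : ∀ j o → 2 ℕ.* (suc j ℕ.+ o) ≡ j ℕ.+ (2 ℕ.+ j ℕ.+ 2 ℕ.* o)
    double-split = ℕ-solve-∀
    reassoc₂ : ∀ x y z → x * (x * (y * z)) ≡ x * x * y * z
    reassoc₂ = solve-∀
    reassoc₁ : ∀ x y z → x * (y * z) ≡ x * y * z
    reassoc₁ = solve-∀

  module _ {j : ℕ} (j<k : j ℕ.< k) where
    private
      o : ℕ
      o = k ℕ.∸ suc j
      2k∸j : 2 ℕ.* k ℕ.∸ j ≡ 2 ℕ.+ j ℕ.+ 2 ℕ.* o
      2k∸j = trans (cong (λ m → 2 ℕ.* m ℕ.∸ j) (sym (ℕ.m+[n∸m]≡n j<k)))
                   (trans (cong (ℕ._∸ j) (double-split j o)) (ℕ.m+n∸m≡n j _))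
      2k∸1+j : 2 ℕ.* k ℕ.∸ suc j ≡ suc (j ℕ.+ 2 ℕ.* o)
      2k∸1+j = trans (sym (ℕ.pred[m∸n]≡m∸[1+n] (2 ℕ.* k) j)) (cong ℕ.pred 2k∸j)

    Y-eq : B.Y j ≡ R ^ (2 ℕ.* k ℕ.∸ j)
    Y-eq = trans (cong (λ r → r * r * X j * W j) R-block)
             (sym (trans (cong (R ^_) 2k∸j) (trans (cong (λ x → R * (R * x)) (^-distribˡ-+-* R j _))
                                                   (reassoc₂ R (X j) (W j)))))

    Z-eq : B.Z j ≡ R ^ (2 ℕ.* k ℕ.∸ suc j)
    Z-eq = trans (cong (λ r → r * X j * W j) R-block)
             (sym (trans (cong (R ^_) 2k∸1+j) (trans (cong (R *_) (^-distribˡ-+-* R j _))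
                                                     (reassoc₁ R (X j) (W j)))))

    T-eq : B.T j ≡ R ^ (2 ℕ.* k)
    T-eq = trans (cong (X j *_) Y-eq)
             (trans (sym (^-distribˡ-+-* R j _)) (cong (R ^_) (ℕ.m+[n∸m]≡n j≤2k)))
      where
      j≤2k : j ℕ.≤ 2 ℕ.* k
      j≤2k = ℕ.≤-trans (ℕ.<⇒≤ j<k) (ℕ.m≤m+n k _)

    A-eq : B.A j ≡ A
    A-eq = cong (λ t → + b * t - + s) T-eq

    D-eq : B.D j ≡ D
    D-eq = cong₂ (λ t a → t + a * a) T-eq A-eq

    eZ-eq : B.eZ j ≡ + (2 ℕ.* b) * (R ^ (2 ℕ.* k ℕ.∸ 1 ℕ.∸ j)) - 1ℤ
    eZ-eq = cong₂ (λ c z → c * z - 1ℤ) (sym (pos-* 2 b))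
              (trans Z-eq (cong (R ^_) (sym (ℕ.∸-+-assoc (2 ℕ.* k) 1 j))))

  RX-eq : ∀ j → B.R j * X j ≡ R ^ suc j
  RX-eq j = cong (_* X j) R-block

  eX-eq : ∀ j → B.eX j ≡ + (2 ℕ.* b) * (R ^ j) - 1ℤ
  eX-eq j = cong (λ c → c * R ^ j - 1ℤ) (sym (pos-* 2 b))

  p-in q-in e-in : ℕ → ℕ → ℤ
  p-in 0             j = A
  p-in 1             j = B.P₁ j
  p-in (suc (suc _)) j = B.P₂ j
  q-in 0             j = R ^ (2 ℕ.* k ℕ.∸ j)
  q-in 1             j = B.Q₁ j
  q-in (suc (suc _)) j = R ^ suc j
  e-in 0             j = + (2 ℕ.* b) * (R ^ j) - 1ℤ
  e-in 1             j = 1ℤ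
  e-in (suc (suc _)) j = + (2 ℕ.* b) * (R ^ (2 ℕ.* k ℕ.∸ 1 ℕ.∸ j)) - 1ℤ

  -- The chain index 1 + r + 3j is state r of block j.
  p q d : ℕ → ℤ
  p zero    = A
  p (suc t) = p-in (t % 3) (t / 3)
  q zero    = 1ℤ
  q (suc t) = q-in (t % 3) (t / 3)
  d zero    = + 2 * A
  d (suc t) = eSeq b s k t

  eSeq-in : ∀ t → eSeq b s k t ≡ e-in (t % 3) (t / 3)
  eSeq-in t with t % 3
  ... | 0           = refl
  ... | 1           = refl
  ... | suc (suc _) = refl

  at-block : ∀ {r} j → r ℕ.< 3 →
    p (suc (r ℕ.+ j ℕ.* 3)) ≡ p-in r j × q (suc (r ℕ.+ j ℕ.* 3)) ≡ q-in r j
    × d (suc (r ℕ.+ j ℕ.* 3)) ≡ e-in r j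
  at-block {r} j r<3 =
    cong₂ p-in mod≡ div≡ , cong₂ q-in mod≡ div≡ , trans (eSeq-in (r ℕ.+ j ℕ.* 3)) (cong₂ e-in mod≡ div≡)
    where
    mod≡ : (r ℕ.+ j ℕ.* 3) % 3 ≡ r
    mod≡ = trans ([m+kn]%n≡m%n r j 3) (m<n⇒m%n≡m r<3)
    div≡ : (r ℕ.+ j ℕ.* 3) / 3 ≡ j
    div≡ = trans (+-distrib-/-∣ʳ r (n∣m*n j)) (cong₂ ℕ._+_ (m<n⇒m/n≡0 r<3) (m*n/n≡m j 3))

  Forward : ℕ → Set
  Forward u = Step D (p u) (q u) (d u) (p (suc u)) (q (suc u))

  block-step : ∀ r j → r ℕ.< 3 → j ℕ.< k → Forward (suc (r ℕ.+ j ℕ.* 3))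
  block-step 0 j _ j<k with at-block j (s≤s z≤n) | at-block j (s≤s (s≤s z≤n))
  ... | P≡ , Q≡ , a≡ | P′≡ , Q′≡ , _ =
    Step-cong (sym (D-eq j<k)) (trans P≡ (sym (A-eq j<k))) (trans Q≡ (sym (Y-eq j<k)))
              (trans a≡ (sym (eX-eq j))) P′≡ Q′≡ (B.step₀ j)
  block-step 1 j _ j<k with at-block j (s≤s (s≤s z≤n)) | at-block j (s≤s (s≤s (s≤s z≤n)))
  ... | P≡ , Q≡ , a≡ | P′≡ , Q′≡ , _ =
    Step-cong (sym (D-eq j<k)) P≡ Q≡ a≡ P′≡ (trans Q′≡ (sym (RX-eq j))) (B.step₁ j)
  block-step 2 j _ j<k with at-block j (s≤s (s≤s (s≤s z≤n))) | at-block (suc j) (s≤s z≤n)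
  ... | P≡ , Q≡ , a≡ | P′≡ , Q′≡ , _ =
    Step-cong (sym (D-eq j<k)) P≡ (trans Q≡ (sym (RX-eq j))) (trans a≡ (sym (eZ-eq j<k)))
              (trans P′≡ (sym (A-eq j<k))) (trans Q′≡ (sym (Z-eq j<k))) (B.step₂ j)
  block-step (suc (suc (suc _))) _ (s≤s (s≤s (s≤s ()))) _

  private
    A≥1 : 1ℤ ≤ A
    A≥1 = subst (1ℤ ≤_) (A-eq 1≤k) (B.1≤A 0)

    2k∸k≡k : 2 ℕ.* k ℕ.∸ k ≡ k
    2k∸k≡k = trans (ℕ.m+n∸m≡n k (k ℕ.+ 0)) (ℕ.+-identityʳ k)

    R^≥2 : ∀ {e} → 1 ℕ.≤ e → + 2 ≤ R ^ e
    R^≥2 {suc e} _ = R^suc≥2 e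

    2bR^e-1≥1 : ∀ e → 1ℤ ≤ + (2 ℕ.* b) * (R ^ e) - 1ℤ
    2bR^e-1≥1 e = ≤-by-difference (rearrange (+ (2 ℕ.* b)) (R ^ e))
      (i≤j⇒0≤j-i (+≤+ (ℕ.*-monoʳ-≤ 2 1≤b)) ⊗ ≤-trans (lit 1) (R^≥1 e) ⊕ lit 2 ⊗ i≤j⇒0≤j-i (R^≥1 e))
      where
      rearrange : ∀ c x → c * x - 1ℤ - 1ℤ ≡ (c - + 2) * x + + 2 * (x - 1ℤ)
      rearrange = solve-∀

    p-in≥0 : ∀ r j → 0ℤ ≤ p-in r j
    p-in≥0 0             j = ≤-trans (lit 1) A≥1
    p-in≥0 1             j = B.P₁≥0 j
    p-in≥0 (suc (suc _)) j = B.P₂≥0 j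

    q-in≥2 : ∀ r {j} → j ℕ.≤ k → + 2 ≤ q-in r j
    q-in≥2 0             {j} j≤k =
      R^≥2 (ℕ.≤-trans 1≤k (ℕ.≤-trans (ℕ.≤-reflexive (sym 2k∸k≡k)) (ℕ.∸-monoʳ-≤ (2 ℕ.* k) j≤k)))
    q-in≥2 1             {j} _   = B.Q₁≥2 j
    q-in≥2 (suc (suc _)) {j} _   = R^suc≥2 j

    eSeq≥1 : ∀ t → 1ℤ ≤ eSeq b s k t
    eSeq≥1 t with t % 3
    ... | 0           = 2bR^e-1≥1 (t / 3)
    ... | 1           = ≤-refl
    ... | suc (suc _) = 2bR^e-1≥1 (2 ℕ.* k ℕ.∸ 1 ℕ.∸ t / 3)

  chain : PalindromicChain D A (3 ℕ.* k) p q d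
  chain = record
    { 1≤n    = ℕ.≤-trans 1≤k (ℕ.m≤m+n k _)
    ; p₀     = refl
    ; p₁     = refl
    ; q₀     = refl
    ; d₀     = refl
    ; centre = centre
    ; step   = step
    ; p≥0    = λ {u} _ → p≥0 u
    ; q≥2    = q≥2
    ; d≥1    = λ {u} _ → d≥1 u
    }
    where
    open ≡-Reasoning
    k′ : ℕ
    k′ = ℕ.pred k
    1+k′≡k : suc k′ ≡ k
    1+k′≡k = ℕ.suc-pred k {{ℕ.>-nonZero 1≤k}}
    three-blocks : ∀ k′ → suc (2 ℕ.+ k′ ℕ.* 3) ≡ 3 ℕ.* suc k′
    three-blocks = ℕ-solve-∀
    -- The centre state (A, R^k) follows the last state (P₂, R^k) of block k − 1.
    centre : q (suc (3 ℕ.* k)) ≡ q (3 ℕ.* k)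
    centre = begin
      q (suc (3 ℕ.* k))           ≡⟨ cong (q ∘ suc) (ℕ.*-comm 3 k) ⟩
      q (suc (0 ℕ.+ k ℕ.* 3))     ≡⟨ proj₁ (proj₂ (at-block k (s≤s z≤n))) ⟩
      R ^ (2 ℕ.* k ℕ.∸ k)         ≡⟨ cong (R ^_) (trans 2k∸k≡k (sym 1+k′≡k)) ⟩
      R ^ suc k′                  ≡⟨ sym (proj₁ (proj₂ (at-block k′ (s≤s (s≤s (s≤s z≤n)))))) ⟩
      q (suc (2 ℕ.+ k′ ℕ.* 3))    ≡⟨ cong q (trans (three-blocks k′) (cong (3 ℕ.*_) 1+k′≡k)) ⟩
      q (3 ℕ.* k)                 ∎
    step : ∀ {u} → u ℕ.≤ 3 ℕ.* k → Forward u
    step {zero}  _    = Step-cong (sym (D-eq 1≤k)) (sym (A-eq 1≤k)) refl (cong (+ 2 *_) (sym (A-eq 1≤k)))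
                                  (sym (A-eq 1≤k)) (sym (T-eq 1≤k)) (B.top-step 0)
    step {suc t} t<3k = subst (Forward ∘ suc) (sym (m≡m%n+[m/n]*n t 3))
      (block-step (t % 3) (t / 3) (m%n<n t 3) (m<n*o⇒m/o<n (subst (t ℕ.<_) (ℕ.*-comm 3 k) t<3k)))
    p≥0 : ∀ u → 0ℤ ≤ p u
    p≥0 zero    = p-in≥0 0 0
    p≥0 (suc t) = p-in≥0 (t % 3) (t / 3)
    q≥2 : ∀ {u} → 1 ℕ.≤ u → u ℕ.≤ suc (3 ℕ.* k) → + 2 ≤ q u
    q≥2 {suc t} _ (s≤s t≤3k) = q-in≥2 (t % 3)
      (ℕ.≤-trans (/-monoˡ-≤ 3 t≤3k) (ℕ.≤-reflexive (trans (cong (_/ 3) (ℕ.*-comm 3 k)) (m*n/n≡m k 3))))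
    d≥1 : ∀ u → 1ℤ ≤ d u
    d≥1 zero    = ≤-trans A≥1 (≤-by-difference (twice-minus-once A) (≤-trans (lit 1) A≥1))
      where
      twice-minus-once : ∀ A → + 2 * A - A ≡ A
      twice-minus-once = solve-∀
    d≥1 (suc t) = eSeq≥1 t

  6k≡3k+3k : 6 ℕ.* k ≡ 3 ℕ.* k ℕ.+ 3 ℕ.* k
  6k≡3k+3k = halves k
    where
    halves : ∀ k → 6 ℕ.* k ≡ 3 ℕ.* k ℕ.+ 3 ℕ.* k
    halves = ℕ-solve-∀

  cfSeq-suc : ∀ m → cfSeq b s k (suc m) ≡ d (fold (3 ℕ.* k) (m % suc (3 ℕ.* k ℕ.+ 3 ℕ.* k)))
  cfSeq-suc m = subst (λ n → cfSeq b s k (suc m) ≡ d (fold (3 ℕ.* k) (m % suc n))) 6k≡3k+3k (by-position m)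
    where
    by-position : ∀ m → cfSeq b s k (suc m) ≡ d (fold (3 ℕ.* k) (m % suc (6 ℕ.* k)))
    by-position m with m % suc (6 ℕ.* k) ℕ.<? 3 ℕ.* k | m % suc (6 ℕ.* k) ℕ.<? 6 ℕ.* k
    ... | yes _ | _        = refl
    ... | no _  | yes i<6k = cong d (sym (trans (cong (ℕ._∸ i) (sym 6k≡3k+3k))
                               (trans (∸-suc i<6k) (cong suc (sym (ℕ.∸-+-assoc (6 ℕ.* k) 1 i))))))
      where i = m % suc (6 ℕ.* k)
    ... | no _  | no i≮6k  = cong d (sym (ℕ.m≤n⇒m∸n≡0 (subst (ℕ._≤ i) 6k≡3k+3k (ℕ.≮⇒≥ i≮6k))))
      where i = m % suc (6 ℕ.* k)

open Expansion using (palindromic-expansion; lIs-of-expansion)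
open import Data.Nat using (ℕ; _≤_; _*_; suc)
open import Data.Product using (_×_)

corollary6 : (b s k : ℕ) → 1 ≤ b → 1 ≤ s → 1 ≤ k →
    IsCFSqrt (Dof b s k) (cfSeq b s k) × lIs (Dof b s k) (suc (6 * k))
corollary6 b s k 1≤b 1≤s 1≤k = expansion , lIs-of-expansion expansion fundamental
  where
  open Corollary6 b s k 1≤b 1≤s 1≤k using (chain; cfSeq-suc; 6k≡3k+3k)
  result : IsCFSqrt (Dof b s k) (cfSeq b s k) × IsFundamentalPeriod (cfSeq b s k) (suc (3 * k ℕ.+ 3 * k))
  result = palindromic-expansion chain (cfSeq b s k) refl cfSeq-suc
  expansion : IsCFSqrt (Dof b s k) (cfSeq b s k)
  expansion = proj₁ result
  fundamental : IsFundamentalPeriod (cfSeq b s k) (suc (6 * k))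
  fundamental = subst (λ n → IsFundamentalPeriod (cfSeq b s k) (suc n)) (sym 6k≡3k+3k) (proj₂ result)
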